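{- Let $\underline{B}$ be a subordination algebra and let $\mathrm{Con}(\underline{B})$ be the set of congruences on $\underline{B}$ ordered by inclusion. Then $\mathrm{Con}(\underline{B})$ is a frame (complete Heyting algebra) in which finite meets are intersections and arbitrary joins are joins computed in the lattice of equivalence relations on $B$.
   Context: A subordination algebra is a pair $(B,\prec)$, $B$ a Boolean algebra, $\prec\subseteq B\times B$ with: $0\prec 0$, $1\prec 1$; $a\prec b,c\Rightarrow a\prec b\wedge c$; $b,c\prec a\Rightarrow b\vee c\prec a$; $a\le b\prec c\le d\Rightarrow a\prec d$. A morphism (in $\mathbf{Sub}$) between subordination algebras is a Boolean homomorphism $f:B\to C$ with $a\prec b\Rightarrow f(a)\prec f(b)$ and such that $f(a)\prec c$ implies $a\prec b$ and $f(b)\le c$ for some $b\in B$. A congruence on $\underline{B}$ is an equivalence relation on $B$ of the form $\{(a,b): f(a)=f(b)\}$ for some morphism $f$ with domain $\underline{B}$. -}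

module Defs where

open import Level using (Level; suc; _⊔_; Lift)
open import Data.Product using (Σ; _×_; ∃-syntax)
open import Data.Unit.Polymorphic renaming (⊤ to Unit)
open import Relation.Binary using (Rel)
open import Algebra.Lattice.Bundles using (BooleanAlgebra)

record SubordinationAlgebra (ℓ : Level) : Set (suc ℓ) where
  field
    ba : BooleanAlgebra ℓ ℓ
  open BooleanAlgebra ba public
  _≤_ : Rel Carrier ℓ
  a ≤ b = (a ∧ b) ≈ a
  field
    _≺_ : Rel Carrier ℓ
    ≺-⊥ : ⊥ ≺ ⊥
    ≺-⊤ : ⊤ ≺ ⊤
    ≺-∧ : ∀ {a b c} → a ≺ b → a ≺ c → a ≺ (b ∧ c)
    ≺-∨ : ∀ {a b c} → b ≺ a → c ≺ a → (b ∨ c) ≺ a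
    ≤≺≤ : ∀ {a b c d} → a ≤ b → b ≺ c → c ≤ d → a ≺ d

record IsSubMorphism {ℓ} (B C : SubordinationAlgebra ℓ)
    (f : SubordinationAlgebra.Carrier B → SubordinationAlgebra.Carrier C)
    : Set ℓ where
  private
    module B = SubordinationAlgebra B
    module C = SubordinationAlgebra C
  field
    cong  : ∀ {a b} → a B.≈ b → f a C.≈ f b
    hom-∨ : ∀ a b → f (a B.∨ b) C.≈ (f a C.∨ f b)
    hom-∧ : ∀ a b → f (a B.∧ b) C.≈ (f a C.∧ f b)
    hom-¬ : ∀ a → f (B.¬ a) C.≈ (C.¬ f a)
    hom-⊤ : f B.⊤ C.≈ C.⊤
    hom-⊥ : f B.⊥ C.≈ C.⊥
    pres-≺ : ∀ {a b} → a B.≺ b → f a C.≺ f b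
    back-≺ : ∀ {a c} → f a C.≺ c → ∃[ b ] (a B.≺ b × f b C.≤ c)

module _ {ℓ : Level} (B : SubordinationAlgebra ℓ) where
  open SubordinationAlgebra B

  IsCongruence : Rel Carrier ℓ → Set (suc ℓ)
  IsCongruence R =
    Σ (SubordinationAlgebra ℓ) λ C →
    Σ (Carrier → SubordinationAlgebra.Carrier C) λ f →
      IsSubMorphism B C f ×
      (∀ a b → (R a b → SubordinationAlgebra._≈_ C (f a) (f b))
             × (SubordinationAlgebra._≈_ C (f a) (f b) → R a b))

  _⊆_ : Rel Carrier ℓ → Rel Carrier ℓ → Set ℓ
  R ⊆ S = ∀ a b → R a b → S a b

  _∩_ : Rel Carrier ℓ → Rel Carrier ℓ → Rel Carrier ℓ
  (R ∩ S) a b = R a b × S a b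

  Full : Rel Carrier ℓ
  Full _ _ = Unit

  -- Join in the lattice of equivalence relations on B (B being the setoid
  -- (Carrier, ≈)): the least equivalence relation containing ≈ and all θ i.
  data EqJoin {I : Set ℓ} (θ : I → Rel Carrier ℓ) : Rel Carrier ℓ where
    ej-≈     : ∀ {a b} → a ≈ b → EqJoin θ a b
    ej-incl  : ∀ {a b} (i : I) → θ i a b → EqJoin θ a b
    ej-sym   : ∀ {a b} → EqJoin θ a b → EqJoin θ b a
    ej-trans : ∀ {a b c} → EqJoin θ a b → EqJoin θ b c → EqJoin θ a c

-- The congruences of a subordination algebra B are exactly the Boolean
-- congruences E of B satisfying the back condition: E a a' and a' ≺ b give
-- some b' with a ≺ b' and [b'] ≤ [b] in B/E.  Indeed kernels satisfy it, and
-- conversely, setting [a] ≺ [c] iff a' ≺ b for some a' ∈ [a] and some b with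
-- [b] ≤ [c] makes the projection B → B/E a Sub-morphism.  Both conditions are
-- stable under intersections and under joins of equivalence relations; for
-- the back condition along a chain a = x₀ θ x₁ θ … θ xₙ = a' one lifts a
-- subordinate of a' step by step to one of a.  For distributivity, given
-- R a b and a θ-chain from a to b, the map g x = (x ∧ (a ⊕ b)) ∨ (a ∧ b)
-- fixes a and b, preserves every θ i, and sends all of B into a single
-- R-class because a ⊕ b is R-related to a ⊕ a = ⊥; so g turns the chain into
-- an R ∩ θ-chain.
module Submission where

open import Defs
open import Level using (Level; _⊔_)
open import Function using (id)
open import Data.Product using (_×_; _,_; proj₁; proj₂; ∃-syntax)
open import Data.Unit.Polymorphic using (tt)
open import Relation.Binary using (Rel; _⇒_; IsEquivalence)
open import Algebra.Lattice.Bundles using (BooleanAlgebra)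
import Algebra.Lattice.Properties.BooleanAlgebra as BooleanAlgebraProperties
import Relation.Binary.Reasoning.Setoid as SetoidReasoning

module SubordinationAlgebraProperties {ℓ : Level} (A : SubordinationAlgebra ℓ) where
  open SubordinationAlgebra A
  open BooleanAlgebraProperties ba using (∧-idem; ∧-identityʳ)

  ≤-reflexive : ∀ {x y} → x ≈ y → x ≤ y
  ≤-reflexive {x} x≈y = trans (∧-congˡ (sym x≈y)) (∧-idem x)

  ≤-refl : ∀ {x} → x ≤ x
  ≤-refl = ≤-reflexive refl

  x∧y≤x : ∀ {x y} → (x ∧ y) ≤ x
  x∧y≤x {x} {y} = begin
    (x ∧ y) ∧ x  ≈⟨ ∧-comm _ x ⟩
    x ∧ (x ∧ y)  ≈⟨ ∧-assoc x x y ⟨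
    (x ∧ x) ∧ y  ≈⟨ ∧-congʳ (∧-idem x) ⟩
    x ∧ y        ∎
    where open SetoidReasoning setoid

  x∧y≤y : ∀ {x y} → (x ∧ y) ≤ y
  x∧y≤y {x} {y} = trans (∧-assoc x y y) (∧-congˡ (∧-idem y))

  x≤x∨y : ∀ {x y} → x ≤ (x ∨ y)
  x≤x∨y {x} {y} = ∧-absorbs-∨ x y

  y≤x∨y : ∀ {x y} → y ≤ (x ∨ y)
  y≤x∨y {x} {y} = trans (∧-congˡ (∨-comm x y)) (∧-absorbs-∨ y x)

  x≤⊤ : ∀ {x} → x ≤ ⊤
  x≤⊤ {x} = ∧-identityʳ x

  ≤-≺-trans : ∀ {x y z} → x ≤ y → y ≺ z → x ≺ z
  ≤-≺-trans x≤y y≺z = ≤≺≤ x≤y y≺z ≤-refl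

  ≺-≤-trans : ∀ {x y z} → x ≺ y → y ≤ z → x ≺ z
  ≺-≤-trans = ≤≺≤ ≤-refl

record IsBooleanCongruence {c ℓ₁ ℓ₂} (A : BooleanAlgebra c ℓ₁)
         (E : Rel (BooleanAlgebra.Carrier A) ℓ₂) : Set (c ⊔ ℓ₁ ⊔ ℓ₂) where
  open BooleanAlgebra A using (_≈_; _∧_; _∨_; ¬_)
  field
    isEquivalence : IsEquivalence E
    reflexive     : _≈_ ⇒ E
    ∧-cong        : ∀ {a b c d} → E a b → E c d → E (a ∧ c) (b ∧ d)
    ∨-cong        : ∀ {a b c d} → E a b → E c d → E (a ∨ c) (b ∨ d)
    ¬-cong        : ∀ {a b} → E a b → E (¬ a) (¬ b)
  open IsEquivalence isEquivalence public using (refl; sym; trans)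

module Congruences {ℓ : Level} (B : SubordinationAlgebra ℓ) where
  open SubordinationAlgebra B
  open SubordinationAlgebraProperties B
  open BooleanAlgebraProperties ba using (∧-idem; ∧-zeroʳ; ∧-identityʳ)

  -- The order of B/E, read on representatives.
  _≤[_]_ : Carrier → Rel Carrier ℓ → Carrier → Set ℓ
  x ≤[ E ] y = E (x ∧ y) x

  module QuotientOrder {E : Rel Carrier ℓ} (isBC : IsBooleanCongruence ba E) where
    private module E = IsBooleanCongruence isBC

    ≤⇒≤[] : ∀ {x y} → x ≤ y → x ≤[ E ] y
    ≤⇒≤[] = E.reflexive

    ≤[]-trans : ∀ {x y z} → x ≤[ E ] y → y ≤[ E ] z → x ≤[ E ] z
    ≤[]-trans {x} {y} {z} x≤y y≤z =
      E.trans (E.∧-cong (E.sym x≤y) E.refl)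
        (E.trans (E.reflexive (∧-assoc x y z)) (E.trans (E.∧-cong E.refl y≤z) x≤y))

    ∧-mono-≤[] : ∀ {x y u v} → x ≤[ E ] y → u ≤[ E ] v → (x ∧ u) ≤[ E ] (y ∧ v)
    ∧-mono-≤[] {x} {y} {u} {v} x≤y u≤v =
      E.trans (E.reflexive interchange) (E.∧-cong x≤y u≤v)
      where
      open SetoidReasoning setoid
      interchange : ((x ∧ u) ∧ (y ∧ v)) ≈ ((x ∧ y) ∧ (u ∧ v))
      interchange = begin
        (x ∧ u) ∧ (y ∧ v)  ≈⟨ ∧-assoc x u _ ⟩
        x ∧ (u ∧ (y ∧ v))  ≈⟨ ∧-congˡ (∧-assoc u y v) ⟨
        x ∧ ((u ∧ y) ∧ v)  ≈⟨ ∧-congˡ (∧-congʳ (∧-comm u y)) ⟩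
        x ∧ ((y ∧ u) ∧ v)  ≈⟨ ∧-congˡ (∧-assoc y u v) ⟩
        x ∧ (y ∧ (u ∧ v))  ≈⟨ ∧-assoc x y _ ⟨
        (x ∧ y) ∧ (u ∧ v)  ∎

    ∨-lub-≤[] : ∀ {x y z} → x ≤[ E ] z → y ≤[ E ] z → (x ∨ y) ≤[ E ] z
    ∨-lub-≤[] {x} {y} {z} x≤z y≤z =
      E.trans (E.reflexive (∧-distribʳ-∨ z x y)) (E.∨-cong x≤z y≤z)

  SubordinatesLift : Rel Carrier ℓ → Carrier → Carrier → Set ℓ
  SubordinatesLift E a a' = ∀ {b} → a' ≺ b → ∃[ b' ] (a ≺ b' × b' ≤[ E ] b)

  BackCondition : Rel Carrier ℓ → Set ℓ
  BackCondition E = ∀ {a a'} → E a a' → SubordinatesLift E a a'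

  module Quotient (E : Rel Carrier ℓ) (isBC : IsBooleanCongruence ba E) where
    private module E = IsBooleanCongruence isBC
    open QuotientOrder isBC

    quotientBooleanAlgebra : BooleanAlgebra ℓ ℓ
    quotientBooleanAlgebra = record
      { Carrier = Carrier ; _≈_ = E ; _∨_ = _∨_ ; _∧_ = _∧_ ; ¬_ = ¬_ ; ⊤ = ⊤ ; ⊥ = ⊥
      ; isBooleanAlgebra = record
        { isDistributiveLattice = record
          { isLattice = record
            { isEquivalence = E.isEquivalence
            ; ∨-comm        = λ x y → E.reflexive (∨-comm x y)
            ; ∨-assoc       = λ x y z → E.reflexive (∨-assoc x y z)
            ; ∨-cong        = E.∨-cong
            ; ∧-comm        = λ x y → E.reflexive (∧-comm x y)
            ; ∧-assoc       = λ x y z → E.reflexive (∧-assoc x y z)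
            ; ∧-cong        = E.∧-cong
            ; absorptive    = (λ x y → E.reflexive (∨-absorbs-∧ x y))
                            , (λ x y → E.reflexive (∧-absorbs-∨ x y))
            }
          ; ∨-distrib-∧ = (λ x y z → E.reflexive (∨-distribˡ-∧ x y z))
                        , (λ x y z → E.reflexive (∨-distribʳ-∧ x y z))
          ; ∧-distrib-∨ = (λ x y z → E.reflexive (∧-distribˡ-∨ x y z))
                        , (λ x y z → E.reflexive (∧-distribʳ-∨ x y z))
          }
        ; ∨-complement = (λ x → E.reflexive (∨-complementˡ x))
                       , (λ x → E.reflexive (∨-complementʳ x))
        ; ∧-complement = (λ x → E.reflexive (∧-complementˡ x))
                       , (λ x → E.reflexive (∧-complementʳ x))
        ; ¬-cong = E.¬-cong
        }
      }

    _≺[E]_ : Rel Carrier ℓ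
    a ≺[E] c = ∃[ a' ] ∃[ b ] (E a a' × a' ≺ b × b ≤[ E ] c)

    quotient : SubordinationAlgebra ℓ
    quotient = record
      { ba  = quotientBooleanAlgebra
      ; _≺_ = _≺[E]_
      ; ≺-⊥ = ⊥ , ⊥ , E.refl , ≺-⊥ , ≤⇒≤[] ≤-refl
      ; ≺-⊤ = ⊤ , ⊤ , E.refl , ≺-⊤ , ≤⇒≤[] ≤-refl
      ; ≺-∧ = λ { {a} (a₁ , b₁ , a~a₁ , a₁≺b₁ , b₁≤b) (a₂ , b₂ , a~a₂ , a₂≺b₂ , b₂≤c) →
                    a₁ ∧ a₂ , b₁ ∧ b₂
                  , E.trans (E.reflexive (sym (∧-idem a))) (E.∧-cong a~a₁ a~a₂)
                  , ≺-∧ (≤-≺-trans x∧y≤x a₁≺b₁) (≤-≺-trans x∧y≤y a₂≺b₂)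
                  , ∧-mono-≤[] b₁≤b b₂≤c }
      ; ≺-∨ = λ { (b₁ , c₁ , b~b₁ , b₁≺c₁ , c₁≤a) (b₂ , c₂ , c~b₂ , b₂≺c₂ , c₂≤a) →
                    b₁ ∨ b₂ , c₁ ∨ c₂
                  , E.∨-cong b~b₁ c~b₂
                  , ≺-∨ (≺-≤-trans b₁≺c₁ x≤x∨y) (≺-≤-trans b₂≺c₂ y≤x∨y)
                  , ∨-lub-≤[] c₁≤a c₂≤a }
      ; ≤≺≤ = λ { {a} a≤b (b' , c' , b~b' , b'≺c' , c'≤c) c≤d →
                    a ∧ b' , c'
                  , E.trans (E.sym a≤b) (E.∧-cong E.refl b~b')
                  , ≤-≺-trans x∧y≤y b'≺c'
                  , ≤[]-trans c'≤c c≤d }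
      }

    projection-isSubMorphism : BackCondition E → IsSubMorphism B quotient id
    projection-isSubMorphism back = record
      { cong   = E.reflexive
      ; hom-∨  = λ _ _ → E.refl
      ; hom-∧  = λ _ _ → E.refl
      ; hom-¬  = λ _ → E.refl
      ; hom-⊤  = E.refl
      ; hom-⊥  = E.refl
      ; pres-≺ = λ {a} {b} a≺b → a , b , E.refl , a≺b , ≤⇒≤[] ≤-refl
      ; back-≺ = λ { (a' , b , a~a' , a'≺b , b≤c) →
                     let (b' , a≺b' , b'≤b) = back a~a' a'≺b
                     in b' , a≺b' , ≤[]-trans b'≤b b≤c }
      }

  backCondition⇒isCongruence : ∀ {E} → IsBooleanCongruence ba E → BackCondition E →
                               IsCongruence B E
  backCondition⇒isCongruence {E} isBC back =
    quotient , id , projection-isSubMorphism back , λ _ _ → id , id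
    where open Quotient E isBC

  module Kernel {R : Rel Carrier ℓ} (isCong : IsCongruence B R) where
    private
      C       = proj₁ isCong
      f       = proj₁ (proj₂ isCong)
      isMor   = proj₁ (proj₂ (proj₂ isCong))
      ker     = proj₂ (proj₂ (proj₂ isCong))
      module C = SubordinationAlgebra C
      module f = IsSubMorphism isMor

      R⇒≈ : ∀ {a b} → R a b → f a C.≈ f b
      R⇒≈ {a} {b} = proj₁ (ker a b)

      ≈⇒R : ∀ {a b} → f a C.≈ f b → R a b
      ≈⇒R {a} {b} = proj₂ (ker a b)

    isBooleanCongruence : IsBooleanCongruence ba R
    isBooleanCongruence = record
      { isEquivalence = record
        { refl  = ≈⇒R C.refl
        ; sym   = λ aRb → ≈⇒R (C.sym (R⇒≈ aRb))
        ; trans = λ aRb bRc → ≈⇒R (C.trans (R⇒≈ aRb) (R⇒≈ bRc))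
        }
      ; reflexive = λ a≈b → ≈⇒R (f.cong a≈b)
      ; ∧-cong = λ {a} {b} {c} {d} aRb cRd →
          ≈⇒R (C.trans (f.hom-∧ a c) (C.trans (C.∧-cong (R⇒≈ aRb) (R⇒≈ cRd))
                                              (C.sym (f.hom-∧ b d))))
      ; ∨-cong = λ {a} {b} {c} {d} aRb cRd →
          ≈⇒R (C.trans (f.hom-∨ a c) (C.trans (C.∨-cong (R⇒≈ aRb) (R⇒≈ cRd))
                                              (C.sym (f.hom-∨ b d))))
      ; ¬-cong = λ {a} {b} aRb →
          ≈⇒R (C.trans (f.hom-¬ a) (C.trans (C.¬-cong (R⇒≈ aRb)) (C.sym (f.hom-¬ b))))
      }

    backCondition : BackCondition R
    backCondition {a} {a'} aRa' {b} a'≺b =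
      let (b' , a≺b' , fb'≤fb) = f.back-≺ fa≺fb
      in b' , a≺b' , ≈⇒R (C.trans (f.hom-∧ b' b) fb'≤fb)
      where
      module C≤ = SubordinationAlgebraProperties C
      fa≺fb : f a C.≺ f b
      fa≺fb = C≤.≤-≺-trans (C≤.≤-reflexive (R⇒≈ aRa')) (f.pres-≺ a'≺b)

  Full-isBooleanCongruence : IsBooleanCongruence ba (Full B)
  Full-isBooleanCongruence = record
    { isEquivalence = record { refl = tt ; sym = λ _ → tt ; trans = λ _ _ → tt }
    ; reflexive = λ _ → tt
    ; ∧-cong = λ _ _ → tt
    ; ∨-cong = λ _ _ → tt
    ; ¬-cong = λ _ → tt
    }

  Full-backCondition : BackCondition (Full B)
  Full-backCondition _ _ = ⊤ , ≤-≺-trans x≤⊤ ≺-⊤ , tt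

  module _ {R S : Rel Carrier ℓ}
           (isBCʳ : IsBooleanCongruence ba R) (isBCˢ : IsBooleanCongruence ba S) where
    private
      module R = IsBooleanCongruence isBCʳ
      module S = IsBooleanCongruence isBCˢ

    ∩-isBooleanCongruence : IsBooleanCongruence ba (_∩_ B R S)
    ∩-isBooleanCongruence = record
      { isEquivalence = record
        { refl  = R.refl , S.refl
        ; sym   = λ (r , s) → R.sym r , S.sym s
        ; trans = λ (r , s) (r' , s') → R.trans r r' , S.trans s s'
        }
      ; reflexive = λ p → R.reflexive p , S.reflexive p
      ; ∧-cong = λ (r , s) (r' , s') → R.∧-cong r r' , S.∧-cong s s'
      ; ∨-cong = λ (r , s) (r' , s') → R.∨-cong r r' , S.∨-cong s s'
      ; ¬-cong = λ (r , s) → R.¬-cong r , S.¬-cong s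
      }

    ∩-backCondition : BackCondition R → BackCondition S → BackCondition (_∩_ B R S)
    ∩-backCondition backʳ backˢ (r , s) a'≺b =
      let (b₁ , a≺b₁ , b₁≤b) = backʳ r a'≺b
          (b₂ , a≺b₂ , b₂≤b) = backˢ s a'≺b
      in b₁ ∧ b₂ , ≺-∧ a≺b₁ a≺b₂
       , QuotientOrder.≤[]-trans isBCʳ (QuotientOrder.≤⇒≤[] isBCʳ x∧y≤x) b₁≤b
       , QuotientOrder.≤[]-trans isBCˢ (QuotientOrder.≤⇒≤[] isBCˢ x∧y≤y) b₂≤b

  module _ {I : Set ℓ} {θ : I → Rel Carrier ℓ} where

    EqJoin-least : {E : Rel Carrier ℓ} → IsEquivalence E → _≈_ ⇒ E →
                   (∀ i → θ i ⇒ E) → EqJoin B θ ⇒ E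
    EqJoin-least isEq ≈⇒E θ⇒E (ej-≈ p)       = ≈⇒E p
    EqJoin-least isEq ≈⇒E θ⇒E (ej-incl i r)  = θ⇒E i r
    EqJoin-least isEq ≈⇒E θ⇒E (ej-sym p)     = IsEquivalence.sym isEq (EqJoin-least isEq ≈⇒E θ⇒E p)
    EqJoin-least isEq ≈⇒E θ⇒E (ej-trans p q) =
      IsEquivalence.trans isEq (EqJoin-least isEq ≈⇒E θ⇒E p) (EqJoin-least isEq ≈⇒E θ⇒E q)

    EqJoin-map : {ψ : I → Rel Carrier ℓ} (h : Carrier → Carrier) →
                 (∀ {x y} → x ≈ y → h x ≈ h y) →
                 (∀ i {x y} → θ i x y → ψ i (h x) (h y)) →
                 ∀ {x y} → EqJoin B θ x y → EqJoin B ψ (h x) (h y)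
    EqJoin-map h h-cong θ⇒ψ (ej-≈ p)       = ej-≈ (h-cong p)
    EqJoin-map h h-cong θ⇒ψ (ej-incl i r)  = ej-incl i (θ⇒ψ i r)
    EqJoin-map h h-cong θ⇒ψ (ej-sym p)     = ej-sym (EqJoin-map h h-cong θ⇒ψ p)
    EqJoin-map h h-cong θ⇒ψ (ej-trans p q) =
      ej-trans (EqJoin-map h h-cong θ⇒ψ p) (EqJoin-map h h-cong θ⇒ψ q)

    EqJoin-mono : {ψ : I → Rel Carrier ℓ} → (∀ i → θ i ⇒ ψ i) → EqJoin B θ ⇒ EqJoin B ψ
    EqJoin-mono θ⇒ψ = EqJoin-map id id θ⇒ψ

    module _ (isBCθ : ∀ i → IsBooleanCongruence ba (θ i)) where
      private module θ i = IsBooleanCongruence (isBCθ i)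

      EqJoin-isBooleanCongruence : IsBooleanCongruence ba (EqJoin B θ)
      EqJoin-isBooleanCongruence = record
        { isEquivalence = record { refl = ej-≈ refl ; sym = ej-sym ; trans = ej-trans }
        ; reflexive = ej-≈
        ; ∧-cong = λ p q → ej-trans (EqJoin-map _ ∧-congʳ (λ i r → θ.∧-cong i r (θ.refl i)) p)
                                    (EqJoin-map _ ∧-congˡ (λ i r → θ.∧-cong i (θ.refl i) r) q)
        ; ∨-cong = λ p q → ej-trans (EqJoin-map _ ∨-congʳ (λ i r → θ.∨-cong i r (θ.refl i)) p)
                                    (EqJoin-map _ ∨-congˡ (λ i r → θ.∨-cong i (θ.refl i) r) q)
        ; ¬-cong = EqJoin-map ¬_ ¬-cong θ.¬-cong
        }

      private
        open QuotientOrder EqJoin-isBooleanCongruence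

        lift-trans : ∀ {a b c} → SubordinatesLift (EqJoin B θ) a b →
                     SubordinatesLift (EqJoin B θ) b c → SubordinatesLift (EqJoin B θ) a c
        lift-trans lift-ab lift-bc c≺d =
          let (d₁ , b≺d₁ , d₁≤d) = lift-bc c≺d
              (d₂ , a≺d₂ , d₂≤d₁) = lift-ab b≺d₁
          in d₂ , a≺d₂ , ≤[]-trans d₂≤d₁ d₁≤d

        lift-≈ : ∀ {a a'} → a ≈ a' → SubordinatesLift (EqJoin B θ) a a'
        lift-≈ a≈a' {b} a'≺b = b , ≤-≺-trans (≤-reflexive a≈a') a'≺b , ≤⇒≤[] ≤-refl

        lift-θ : ∀ {i a a'} → BackCondition (θ i) → θ i a a' →
                 SubordinatesLift (EqJoin B θ) a a'
        lift-θ {i} back r a'≺b =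
          let (b' , a≺b' , b'≤b) = back r a'≺b in b' , a≺b' , ej-incl i b'≤b

        lift-both : (∀ i → BackCondition (θ i)) → ∀ {a a'} → EqJoin B θ a a' →
                    SubordinatesLift (EqJoin B θ) a a' × SubordinatesLift (EqJoin B θ) a' a
        lift-both back (ej-≈ p)       = lift-≈ p , lift-≈ (sym p)
        lift-both back (ej-incl i r)  = lift-θ (back i) r , lift-θ (back i) (θ.sym i r)
        lift-both back (ej-sym p)     = let (l , l') = lift-both back p in l' , l
        lift-both back (ej-trans p q) =
          let (lp , lp') = lift-both back p
              (lq , lq') = lift-both back q
          in lift-trans lp lq , lift-trans lq' lp'

      EqJoin-backCondition : (∀ i → BackCondition (θ i)) → BackCondition (EqJoin B θ)
      EqJoin-backCondition back p = proj₁ (lift-both back p)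

  _⊕_ : Carrier → Carrier → Carrier
  a ⊕ b = (a ∨ b) ∧ ¬ (a ∧ b)

  open BooleanAlgebraProperties.XorRing ba _⊕_ (λ _ _ → refl) using (⊕-comm; ⊕-inverseˡ)

  x∧[x⊕y]∨[x∧y]≈x : ∀ x y → ((x ∧ (x ⊕ y)) ∨ (x ∧ y)) ≈ x
  x∧[x⊕y]∨[x∧y]≈x x y = begin
    (x ∧ ((x ∨ y) ∧ ¬ (x ∧ y))) ∨ (x ∧ y)  ≈⟨ ∨-congʳ (∧-assoc x _ _) ⟨
    ((x ∧ (x ∨ y)) ∧ ¬ (x ∧ y)) ∨ (x ∧ y)  ≈⟨ ∨-congʳ (∧-congʳ (∧-absorbs-∨ x y)) ⟩
    (x ∧ ¬ (x ∧ y)) ∨ (x ∧ y)              ≈⟨ ∨-congˡ (trans (∧-congʳ (sym (∧-idem x))) (∧-assoc x x y)) ⟩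
    (x ∧ ¬ (x ∧ y)) ∨ (x ∧ (x ∧ y))        ≈⟨ ∧-distribˡ-∨ x _ _ ⟨
    x ∧ (¬ (x ∧ y) ∨ (x ∧ y))              ≈⟨ ∧-congˡ (∨-complementˡ (x ∧ y)) ⟩
    x ∧ ⊤                                  ≈⟨ ∧-identityʳ x ⟩
    x                                      ∎
    where open SetoidReasoning setoid

  module _ {R : Rel Carrier ℓ} (isBCʳ : IsBooleanCongruence ba R) where
    private module R = IsBooleanCongruence isBCʳ

    ⊕-collapse : ∀ {a b} → R a b → R (a ⊕ b) ⊥
    ⊕-collapse {a} aRb =
      R.trans (R.∧-cong (R.∨-cong R.refl (R.sym aRb)) (R.¬-cong (R.∧-cong R.refl (R.sym aRb))))
              (R.reflexive (⊕-inverseˡ a))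

    module _ {I : Set ℓ} {θ : I → Rel Carrier ℓ}
             (isBCθ : ∀ i → IsBooleanCongruence ba (θ i)) where
      private module θ i = IsBooleanCongruence (isBCθ i)

      ∩-EqJoin⊆EqJoin-∩ : _⊆_ B (_∩_ B R (EqJoin B θ)) (EqJoin B (λ i → _∩_ B R (θ i)))
      ∩-EqJoin⊆EqJoin-∩ a b (aRb , chain) =
        ej-trans (ej-≈ (sym (x∧[x⊕y]∨[x∧y]≈x a b)))
          (ej-trans (EqJoin-map g (λ p → ∨-congʳ (∧-congʳ p)) g-θ chain) (ej-≈ gb≈b))
        where
        g : Carrier → Carrier
        g x = (x ∧ (a ⊕ b)) ∨ (a ∧ b)

        g-constant : ∀ x → R (g x) (⊥ ∨ (a ∧ b))
        g-constant x = R.∨-cong (R.trans (R.∧-cong R.refl (⊕-collapse aRb))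
                                         (R.reflexive (∧-zeroʳ x))) R.refl

        g-θ : ∀ i {x y} → θ i x y → _∩_ B R (θ i) (g x) (g y)
        g-θ i r = R.trans (g-constant _) (R.sym (g-constant _))
                , θ.∨-cong i (θ.∧-cong i r (θ.refl i)) (θ.refl i)

        gb≈b : g b ≈ b
        gb≈b = trans (∨-cong (∧-congˡ (⊕-comm a b)) (∧-comm a b)) (x∧[x⊕y]∨[x∧y]≈x b a)

  EqJoin-∩⊆∩-EqJoin : ∀ {R} → IsBooleanCongruence ba R → ∀ {I} (θ : I → Rel Carrier ℓ) →
                      _⊆_ B (EqJoin B (λ i → _∩_ B R (θ i))) (_∩_ B R (EqJoin B θ))
  EqJoin-∩⊆∩-EqJoin isBCʳ θ _ _ chain =
      EqJoin-least R.isEquivalence R.reflexive (λ _ → proj₁) chain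
    , EqJoin-mono (λ _ → proj₂) chain
    where module R = IsBooleanCongruence isBCʳ

corollary2p12 : {ℓ : Level} (B : SubordinationAlgebra ℓ) →
    -- finite meets are intersections: the full relation and binary intersections of congruences are congruences
    IsCongruence B (Full B)
    × (∀ (R S : Rel (SubordinationAlgebra.Carrier B) ℓ) →
         IsCongruence B R → IsCongruence B S → IsCongruence B (_∩_ B R S))
    -- arbitrary joins: the equivalence-relation join of any family of congruences is a congruence
    × (∀ (I : Set ℓ) (θ : I → Rel (SubordinationAlgebra.Carrier B) ℓ) →
         (∀ i → IsCongruence B (θ i)) → IsCongruence B (EqJoin B θ))
    -- frame distributive law: R ∧ ⋁ θ i = ⋁ (R ∧ θ i)
    × (∀ (R : Rel (SubordinationAlgebra.Carrier B) ℓ) (I : Set ℓ)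
         (θ : I → Rel (SubordinationAlgebra.Carrier B) ℓ) →
         IsCongruence B R → (∀ i → IsCongruence B (θ i)) →
         _⊆_ B (_∩_ B R (EqJoin B θ)) (EqJoin B (λ i → _∩_ B R (θ i)))
         × _⊆_ B (EqJoin B (λ i → _∩_ B R (θ i))) (_∩_ B R (EqJoin B θ)))
corollary2p12 B =
    backCondition⇒isCongruence Full-isBooleanCongruence Full-backCondition
  , (λ R S cR cS → backCondition⇒isCongruence
       (∩-isBooleanCongruence (bc cR) (bc cS))
       (∩-backCondition (bc cR) (bc cS) (back cR) (back cS)))
  , (λ I θ cθ → backCondition⇒isCongruence
       (EqJoin-isBooleanCongruence (λ i → bc (cθ i)))
       (EqJoin-backCondition (λ i → bc (cθ i)) (λ i → back (cθ i))))
  , λ R I θ cR cθ → ∩-EqJoin⊆EqJoin-∩ (bc cR) (λ i → bc (cθ i))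
                  , EqJoin-∩⊆∩-EqJoin (bc cR) θ
  where
  open Congruences B
  open Kernel renaming (isBooleanCongruence to bc; backCondition to back)
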